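{- Let $n,k\ge1$ and let $(e_1,\dots,e_k)$ be non-negative integers with $\sum_{i=1}^k e_i=\binom n2$, and run the standard colouring procedure on $K_n$ with respect to $(e_1,\dots,e_k)$. For every $\ell\ge 0$, if $S_\ell=\{K_{m_1},\dots,K_{m_r}\}$ and $m_1\ge 2k$, then a simple colouring step can be performed on $K_{m_1}$, i.e. there is a colour $i\in[k]$ with $e_{\ell,i}\ge m_1-1$.
   Context: Standard colouring procedure: start with the multiset $S_0=\{K_n\}$ and budgets $e_{0,j}=e_j$. At step $\ell\ge0$: if every member of $S_\ell$ is a $K_1$, stop. Otherwise choose $K_m\in S_\ell$ with $m\ge2$, a colour $i\in[k]$ and $1\le t\le\lfloor m/2\rfloor$ with $t(m-t)\le e_{\ell,i}$; split $K_m$ into vertex-disjoint $K_t$ and $K_{m-t}$, colour all $t(m-t)$ edges between them with colour $i$, set $S_{\ell+1}=(S_\ell\setminus\{K_m\})\cup\{K_t,K_{m-t}\}$ (as multisets), $e_{\ell+1,i}=e_{\ell,i}-t(m-t)$ and $e_{\ell+1,j}=e_{\ell,j}$ for $j\neq i$. Such a step is a standard colouring step of size $t$ on $K_m$ with colour $i$; a simple colouring step is one of size $t=1$. -}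

module Defs where

open import Data.Nat using (ℕ; _+_; _*_; _∸_; _≤_; ⌊_/2⌋)
open import Data.Fin using (Fin)
open import Data.List using (List; _∷_; [_])
open import Data.List.Relation.Binary.Permutation.Propositional using (_↭_)
open import Data.Product using (_×_; ∃-syntax)
open import Relation.Binary.PropositionalEquality using (_≡_; _≢_)

-- State of the standard colouring procedure: the multiset S_ℓ of cliques,
-- given as the list of their orders (a list taken up to permutation), and
-- the budget vector e_ℓ : [k] → ℕ.

record ColouringStep {k : ℕ} (S : List ℕ) (e : Fin k → ℕ)
                     (S' : List ℕ) (e' : Fin k → ℕ) : Set where
  field
    m    : ℕ
    rest : List ℕ
    i    : Fin k
    t    : ℕ
    S↭   : S ↭ (m ∷ rest)
    m≥2  : 2 ≤ m
    t≥1  : 1 ≤ t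
    t≤   : t ≤ ⌊ m /2⌋
    fits : t * (m ∸ t) ≤ e i
    S'≡  : S' ≡ t ∷ (m ∸ t) ∷ rest
    e'i  : e' i ≡ e i ∸ t * (m ∸ t)
    e'j  : ∀ j → j ≢ i → e' j ≡ e j

data Reachable {k : ℕ} (n : ℕ) (e₀ : Fin k → ℕ) : ℕ → List ℕ → (Fin k → ℕ) → Set where
  start : Reachable n e₀ 0 [ n ] e₀
  step  : ∀ {ℓ S e S' e'} → Reachable n e₀ ℓ S e → ColouringStep S e S' e' →
          Reachable n e₀ (1 + ℓ) S' e'

-- The budgets still available always add up to the number of uncoloured edges, i.e. to
-- Σ_{K_m ∈ S_ℓ} C(m,2): each step spends t(m−t) and removes exactly the t(m−t) edges between
-- K_t and K_{m−t}. If every budget were at most m−2 for some K_m ∈ S_ℓ with m ≥ 2k, then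
-- C(m,2) ≤ Σ e_{ℓ,i} ≤ k(m−2) ≤ m(m−2)/2 < C(m,2).
module Submission where

open import Defs
open import Data.Nat using (ℕ; zero; suc; _+_; _*_; _∸_; _≤_; _<_; z≤n; s≤s; _<?_)
open import Data.Nat.Properties hiding (suc-injective)
open import Data.Nat.Combinatorics using (_C_; nC1≡n; nCk+nC[k+1]≡[n+1]C[k+1])
open import Data.Nat.ListAction using (sum)
open import Data.Nat.ListAction.Properties using (sum-↭)
open import Data.Nat.Solver using (module +-*-Solver)
open import Data.Fin using (Fin; zero; suc)
open import Data.Fin.Properties using (suc-injective)
open import Data.List using (List; _∷_; map; tabulate)
open import Data.List.Properties using (tabulate-cong)
open import Data.List.Membership.Propositional using (_∈_)
open import Data.List.Membership.Propositional.Properties using (∈-map⁺)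
open import Data.List.Relation.Unary.Any using (here; there)
open import Data.List.Relation.Binary.Permutation.Propositional.Properties using (map⁺)
open import Function using (_∘_)
open import Data.Product using (∃-syntax; _,_)
open import Data.Sum using (_⊎_; inj₁; inj₂)
open import Relation.Nullary using (yes; no; contradiction)
open import Relation.Binary.PropositionalEquality
open +-*-Solver using (solve; _:+_; _:*_; _:=_; con)

internal-edges : List ℕ → ℕ
internal-edges S = sum (map (_C 2) S)

n+1C2≡n+nC2 : ∀ n → suc n C 2 ≡ n + n C 2
n+1C2≡n+nC2 n = trans (sym (nCk+nC[k+1]≡[n+1]C[k+1] n 1)) (cong (_+ n C 2) (nC1≡n n))

[m+n]C2≡mC2+nC2+m*n : ∀ m n → (m + n) C 2 ≡ m C 2 + n C 2 + m * n
[m+n]C2≡mC2+nC2+m*n zero    n = sym (+-identityʳ (n C 2))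
[m+n]C2≡mC2+nC2+m*n (suc m) n = begin
  suc (m + n) C 2                    ≡⟨ n+1C2≡n+nC2 (m + n) ⟩
  m + n + (m + n) C 2                ≡⟨ cong (m + n +_) ([m+n]C2≡mC2+nC2+m*n m n) ⟩
  m + n + (m C 2 + n C 2 + m * n)    ≡⟨ solve 5 (λ m n a b c → m :+ n :+ (a :+ b :+ c)
                                                  := m :+ a :+ b :+ (n :+ c)) refl m n (m C 2) (n C 2) (m * n) ⟩
  m + m C 2 + n C 2 + suc m * n      ≡⟨ cong (λ x → x + n C 2 + suc m * n) (sym (n+1C2≡n+nC2 m)) ⟩
  suc m C 2 + n C 2 + suc m * n      ∎
  where open ≡-Reasoning

2*nC2≡n*[n∸1] : ∀ n → 2 * (n C 2) ≡ n * (n ∸ 1)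
2*nC2≡n*[n∸1] zero          = refl
2*nC2≡n*[n∸1] (suc zero)    = refl
2*nC2≡n*[n∸1] (suc (suc n)) = begin
  2 * (suc (suc n) C 2)        ≡⟨ cong (2 *_) (n+1C2≡n+nC2 (suc n)) ⟩
  2 * (suc n + suc n C 2)      ≡⟨ *-distribˡ-+ 2 (suc n) (suc n C 2) ⟩
  2 * suc n + 2 * (suc n C 2)  ≡⟨ cong (2 * suc n +_) (2*nC2≡n*[n∸1] (suc n)) ⟩
  2 * suc n + suc n * n        ≡⟨ solve 1 (λ n → con 2 :* (con 1 :+ n) :+ (con 1 :+ n) :* n
                                            := (con 2 :+ n) :* (con 1 :+ n)) refl n ⟩
  suc (suc n) * suc n          ∎
  where open ≡-Reasoning

∈⇒≤sum : ∀ {n ns} → n ∈ ns → n ≤ sum ns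
∈⇒≤sum           (here refl)   = m≤m+n _ _
∈⇒≤sum {ns = m ∷ _} (there n∈ns) = ≤-trans (∈⇒≤sum n∈ns) (m≤n+m _ m)

sum-tabulate-update : ∀ {k} (i : Fin k) d (e e′ : Fin k → ℕ) → e′ i + d ≡ e i →
                      (∀ j → j ≢ i → e′ j ≡ e j) → sum (tabulate e′) + d ≡ sum (tabulate e)
sum-tabulate-update zero d e e′ e′i+d≡ei others = begin
  e′ zero + Σe′ + d   ≡⟨ solve 3 (λ a s d → a :+ s :+ d := a :+ d :+ s) refl (e′ zero) Σe′ d ⟩
  e′ zero + d + Σe′   ≡⟨ cong₂ _+_ e′i+d≡ei (cong sum (tabulate-cong (λ j → others (suc j) λ ()))) ⟩
  e zero + Σe         ∎
  where
  open ≡-Reasoning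
  Σe′ = sum (tabulate (λ j → e′ (suc j)))
  Σe  = sum (tabulate (λ j → e (suc j)))
sum-tabulate-update (suc i) d e e′ e′i+d≡ei others = begin
  e′ zero + Σe′ + d    ≡⟨ +-assoc (e′ zero) Σe′ d ⟩
  e′ zero + (Σe′ + d)  ≡⟨ cong₂ _+_ (others zero λ ())
                            (sum-tabulate-update i d (λ j → e (suc j)) (λ j → e′ (suc j)) e′i+d≡ei
                               λ j j≢i → others (suc j) (j≢i ∘ suc-injective)) ⟩
  e zero + Σe          ∎
  where
  open ≡-Reasoning
  Σe′ = sum (tabulate (λ j → e′ (suc j)))
  Σe  = sum (tabulate (λ j → e (suc j)))

some-exceeds⊎sum-tabulate≤ : ∀ k p (e : Fin k → ℕ) → ∃[ i ] (p < e i) ⊎ sum (tabulate e) ≤ k * p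
some-exceeds⊎sum-tabulate≤ zero    p e = inj₂ z≤n
some-exceeds⊎sum-tabulate≤ (suc k) p e with p <? e zero | some-exceeds⊎sum-tabulate≤ k p (λ j → e (suc j))
... | yes p<e₀ | _               = inj₁ (zero , p<e₀)
... | no  _    | inj₁ (i , p<eᵢ) = inj₁ (suc i , p<eᵢ)
... | no  p≮e₀ | inj₂ Σ≤kp      = inj₂ (+-mono-≤ (≮⇒≥ p≮e₀) Σ≤kp)

module _ {k} {S S′ : List ℕ} {e e′ : Fin k → ℕ} (colouring : ColouringStep S e S′ e′) where
  open ColouringStep colouring

  spent : ℕ
  spent = t * (m ∸ t)

  budget-after-step : sum (tabulate e′) + spent ≡ sum (tabulate e)
  budget-after-step = sum-tabulate-update i spent e e′ (trans (cong (_+ spent) e'i) (m∸n+n≡m fits)) e'j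

  internal-edges-after-step : internal-edges S′ + spent ≡ internal-edges S
  internal-edges-after-step = begin
    internal-edges S′ + spent                ≡⟨ cong (λ S″ → internal-edges S″ + spent) S'≡ ⟩
    t C 2 + ((m ∸ t) C 2 + R) + spent        ≡⟨ solve 4 (λ a b r d → a :+ (b :+ r) :+ d := a :+ b :+ d :+ r)
                                                  refl (t C 2) ((m ∸ t) C 2) R spent ⟩
    t C 2 + (m ∸ t) C 2 + spent + R          ≡⟨ cong (_+ R) (sym ([m+n]C2≡mC2+nC2+m*n t (m ∸ t))) ⟩
    (t + (m ∸ t)) C 2 + R                    ≡⟨ cong (λ x → x C 2 + R) (m+[n∸m]≡n t≤m) ⟩
    internal-edges (m ∷ rest)                ≡⟨ sum-↭ (map⁺ (_C 2) S↭) ⟨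
    internal-edges S                         ∎
    where
    open ≡-Reasoning
    R = internal-edges rest
    t≤m : t ≤ m
    t≤m = ≤-trans t≤ (⌊n/2⌋≤n m)

  budget≡internal-edges-step : sum (tabulate e) ≡ internal-edges S → sum (tabulate e′) ≡ internal-edges S′
  budget≡internal-edges-step Σe≡ = +-cancelʳ-≡ _ _ _
    (trans budget-after-step (trans Σe≡ (sym internal-edges-after-step)))

budget≡internal-edges : ∀ {k n ℓ S} {e₀ e : Fin k → ℕ} → sum (tabulate e₀) ≡ n C 2 →
                        Reachable n e₀ ℓ S e → sum (tabulate e) ≡ internal-edges S
budget≡internal-edges {n = n} Σe₀≡ start = trans Σe₀≡ (sym (+-identityʳ (n C 2)))
budget≡internal-edges Σe₀≡ (step r s) = budget≡internal-edges-step s (budget≡internal-edges Σe₀≡ r)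

k*p<[2+p]C2 : ∀ {k p} → 2 * k ≤ 2 + p → k * p < (2 + p) C 2
k*p<[2+p]C2 {k} {p} 2k≤2+p = *-cancelˡ-< 2 (k * p) ((2 + p) C 2) (begin-strict
  2 * (k * p)        ≡⟨ *-assoc 2 k p ⟨
  2 * k * p          ≤⟨ *-monoˡ-≤ p 2k≤2+p ⟩
  (2 + p) * p        <⟨ *-monoʳ-< (2 + p) (n<1+n p) ⟩
  (2 + p) * (1 + p)  ≡⟨ 2*nC2≡n*[n∸1] (2 + p) ⟨
  2 * ((2 + p) C 2)  ∎)
  where open ≤-Reasoning

some-budget-fits-simple-step : ∀ {k m} (e : Fin k → ℕ) → 2 ≤ m → 2 * k ≤ m →
                               m C 2 ≤ sum (tabulate e) → ∃[ i ] (m ∸ 1 ≤ e i)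
some-budget-fits-simple-step {k} {suc (suc p)} e (s≤s (s≤s _)) 2k≤m mC2≤Σe
  with some-exceeds⊎sum-tabulate≤ k p e
... | inj₁ exceeds = exceeds
... | inj₂ Σe≤kp   = contradiction (≤-trans mC2≤Σe Σe≤kp) (<⇒≱ (k*p<[2+p]C2 {k} 2k≤m))

lemma4p5 : (n k : ℕ) → 1 ≤ n → 1 ≤ k → (e₀ : Fin k → ℕ) →
    sum (tabulate e₀) ≡ n C 2 →
    (ℓ : ℕ) (S : List ℕ) (e : Fin k → ℕ) → Reachable n e₀ ℓ S e →
    (m : ℕ) → m ∈ S → 2 * k ≤ m →
    ∃[ i ] (m ∸ 1 ≤ e i)
lemma4p5 n k _ 1≤k e₀ Σe₀≡nC2 ℓ S e reachable m m∈S 2k≤m =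
  some-budget-fits-simple-step e 2≤m 2k≤m (begin
    m C 2               ≤⟨ ∈⇒≤sum (∈-map⁺ (_C 2) m∈S) ⟩
    internal-edges S    ≡⟨ budget≡internal-edges Σe₀≡nC2 reachable ⟨
    sum (tabulate e)    ∎)
  where
  open ≤-Reasoning
  2≤m : 2 ≤ m
  2≤m = ≤-trans (*-monoʳ-≤ 2 1≤k) 2k≤m
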